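{- Let $d,k,n$ be integers with $d\geq 1$ and $2\leq k\leq n$, and let $P_n$ be the path with vertex set $\{1,\ldots,n\}$ and edges $\{i,i+1\}$ for $1\le i\le n-1$. Then \[\mathrm{gp}^k_d(P_n)=\begin{cases} n & \text{if } 1\leq d\leq k-2,\\ (k-1)\left\lfloor\frac{n}{d+1}\right\rfloor+\min\bigl(n \bmod (d+1),\,k-1\bigr) & \text{if } k-1\leq d.\end{cases}\]
   Context: For a graph $G$, a geodesic of $G$ is a shortest path between two vertices of $G$; its length $\lambda(g)$ is its number of edges and $V(g)$ is its vertex set. For integers $d\ge1$, $k\ge2$, a set $S\subseteq V(G)$ is a $k$-general $d$-position set in $G$ if for every geodesic $g$ of $G$, $|S\cap V(g)|\geq k$ implies $\lambda(g)>d$. The $k$-general $d$-position number $\mathrm{gp}^k_d(G)$ is the largest cardinality of a $k$-general $d$-position set in $G$. -}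

module Defs where

open import Data.Nat using (ℕ; zero; suc; _≤_; _<_; _>_)
open import Data.Fin using (Fin; toℕ; _≟_)
open import Data.Fin.Subset using (Subset; _∩_; ∣_∣)
open import Data.Vec using (Vec; []; _∷_; head; last; tabulate)
open import Data.Vec.Relation.Unary.Any using (any?)
open import Data.Bool using (Bool)
open import Data.Product using (Σ; _×_; _,_)
open import Data.Sum using (_⊎_)
open import Data.Empty using (⊥)
open import Relation.Nullary using (¬_; does)
open import Relation.Binary.PropositionalEquality using (_≡_)

record Graph : Set₁ where
  field
    V      : ℕ
    Adj    : Fin V → Fin V → Set
    sym    : ∀ {x y} → Adj x y → Adj y x
    irrefl : ∀ {x} → ¬ Adj x x

module _ (G : Graph) where
  open Graph G

  IsWalk : ∀ {ℓ} → Vec (Fin V) (suc ℓ) → Set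
  IsWalk (x ∷ []) = Data.Unit.⊤
    where import Data.Unit
  IsWalk (x ∷ y ∷ w) = Adj x y × IsWalk (y ∷ w)

  IsGeodesic : ∀ ℓ → Vec (Fin V) (suc ℓ) → Set
  IsGeodesic ℓ w = IsWalk w ×
    (∀ m (w' : Vec (Fin V) (suc m)) → IsWalk w' →
       head w' ≡ head w → last w' ≡ last w → ℓ ≤ m)

  vertexSet : ∀ {ℓ} → Vec (Fin V) (suc ℓ) → Subset V
  vertexSet w = tabulate (λ x → does (any? (x ≟_) w))

  IsGenPos : ℕ → ℕ → Subset V → Set
  IsGenPos k d S = ∀ ℓ (g : Vec (Fin V) (suc ℓ)) → IsGeodesic ℓ g →
    k ≤ ∣ S ∩ vertexSet g ∣ → ℓ > d

  IsGP : ℕ → ℕ → ℕ → Set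
  IsGP k d m = Σ (Subset V) (λ S → IsGenPos k d S × ∣ S ∣ ≡ m)
             × (∀ S → IsGenPos k d S → ∣ S ∣ ≤ m)

-- Path P_n: vertex i : Fin n stands for vertex (toℕ i + 1) ∈ {1,…,n};
-- edges {i, i+1}.
PAdj : ∀ {n} → Fin n → Fin n → Set
PAdj x y = toℕ y ≡ suc (toℕ x) ⊎ toℕ x ≡ suc (toℕ y)

private
  open import Data.Sum using (inj₁; inj₂)
  open import Data.Nat.Properties using (1+n≢n)
  open import Relation.Binary.PropositionalEquality using (sym)

  PAdj-sym : ∀ {n} {x y : Fin n} → PAdj x y → PAdj y x
  PAdj-sym (inj₁ e) = inj₂ e
  PAdj-sym (inj₂ e) = inj₁ e

  PAdj-irrefl : ∀ {n} {x : Fin n} → ¬ PAdj x x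
  PAdj-irrefl {x = x} (inj₁ e) = 1+n≢n (sym e)
  PAdj-irrefl {x = x} (inj₂ e) = 1+n≢n (sym e)

Path : ℕ → Graph
Path n = record { V = n ; Adj = PAdj ; sym = PAdj-sym ; irrefl = PAdj-irrefl }

-- Identify the vertices of P_n with 0, …, n-1.  A walk of length ℓ in P_n stays inside
-- some interval of ℓ+1 consecutive vertices, and every interval of ℓ+1 consecutive vertices
-- is the vertex set of a geodesic of length ℓ.  Hence S is a k-general d-position set iff
-- every interval of at most d+1 vertices contains at most k-1 points of S.  If d+1 < k this
-- holds for S = V(P_n).  Otherwise cut {0, …, n-1} into n mod (d+1) initial vertices followed
-- by ⌊n/(d+1)⌋ blocks of d+1 consecutive vertices: this bounds |S|, and the bound is attained
-- by the vertices whose residue mod (d+1) is less than k-1.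
module Submission where

open import Defs
open import Data.Nat
  using (ℕ; zero; suc; _≤_; _<_; _∸_; _*_; _+_; _⊓_; _/_; _%_; _<ᵇ_; z≤n; s≤s; s≤s⁻¹; z<s; s<s; NonZero)
open import Data.Nat.Properties hiding (_≟_)
open import Data.Nat.DivMod using (m≡m%n+[m/n]*n; [m+n]%n≡m%n; m<n⇒m%n≡m; m%n<n; m%n≤m)
open import Data.Bool using (Bool; true; false; _∧_; T)
open import Data.Bool.Properties using (T-∧)
open import Data.Fin as Fin using (Fin; toℕ; fromℕ<; _≟_)
open import Data.Fin.Properties using (toℕ-fromℕ<)
open import Data.Fin.Subset using (Subset; _∩_; ∣_∣; ⊤)
open import Data.Fin.Subset.Properties using (∣⊤∣≡n; ∣p∣≤n)
open import Data.Vec using (Vec; []; _∷_; head; last; lookup; tabulate)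
open import Data.Vec.Properties using (lookup∘tabulate)
open import Data.Vec.Relation.Unary.Any using (here; there; any?)
open import Data.Vec.Membership.Propositional using (_∈_)
open import Data.Unit using (tt)
open import Data.Empty using (⊥-elim)
open import Data.Product using (_×_; ∃-syntax; _,_; proj₁; proj₂)
open import Data.Sum using (inj₁; inj₂)
open import Function using (_∘_; _$_; Equivalence)
open import Relation.Nullary using (¬_; yes; no; does)
open import Relation.Binary.PropositionalEquality

private
  variable
    ℓ lo m n : ℕ

bit : Bool → ℕ
bit false = 0
bit true  = 1

count : (ℕ → Bool) → ℕ → ℕ
count f zero    = 0
count f (suc n) = bit (f 0) + count (f ∘ suc) n

count-cong : ∀ {f g} n → (∀ {i} → i < n → f i ≡ g i) → count f n ≡ count g n
count-cong zero    _   = refl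
count-cong (suc n) f≗g = cong₂ _+_ (cong bit (f≗g z<s)) (count-cong n (f≗g ∘ s<s))

bit-mono : ∀ {a b} → (T a → T b) → bit a ≤ bit b
bit-mono {false}         _   = z≤n
bit-mono {true}  {true}  _   = ≤-refl
bit-mono {true}  {false} a⇒b = ⊥-elim (a⇒b tt)

count-mono : ∀ {f g} n → (∀ {i} → i < n → T (f i) → T (g i)) → count f n ≤ count g n
count-mono zero    _   = z≤n
count-mono (suc n) f⇒g = +-mono-≤ (bit-mono (f⇒g z<s)) (count-mono n (f⇒g ∘ s<s))

bit-false : ∀ {b} → ¬ T b → bit b ≡ 0
bit-false {false} _  = refl
bit-false {true}  ¬t = ⊥-elim (¬t tt)

count-none : ∀ {f} n → (∀ {i} → i < n → ¬ T (f i)) → count f n ≡ 0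
count-none zero    _    = refl
count-none (suc n) none = cong₂ _+_ (bit-false (none z<s)) (count-none n (none ∘ s<s))

count≤n : ∀ f n → count f n ≤ n
count≤n f zero    = z≤n
count≤n f (suc n) = +-mono-≤ (bit≤1 (f 0)) (count≤n (f ∘ suc) n)
  where
  bit≤1 : ∀ b → bit b ≤ 1
  bit≤1 false = z≤n
  bit≤1 true  = ≤-refl

count-+ : ∀ f m n → count f (m + n) ≡ count f m + count (f ∘ (m +_)) n
count-+ f zero    n = refl
count-+ f (suc m) n =
  trans (cong (bit (f 0) +_) (count-+ (f ∘ suc) m n)) (sym (+-assoc (bit (f 0)) _ _))

count-monoˡ : ∀ f → m ≤ n → count f m ≤ count f n
count-monoˡ {m} {n} f m≤n = begin
  count f m                                 ≤⟨ m≤m+n _ _ ⟩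
  count f m + count (f ∘ (m +_)) (n ∸ m)    ≡⟨ count-+ f m (n ∸ m) ⟨
  count f (m + (n ∸ m))                     ≡⟨ cong (count f) (m+[n∸m]≡n m≤n) ⟩
  count f n                                 ∎
  where open ≤-Reasoning

count-rotate : ∀ f p → f p ≡ f 0 → count (f ∘ suc) p ≡ count f p
count-rotate f p fp≡f0 = +-cancelˡ-≡ (bit (f 0)) _ _ $ begin
  bit (f 0) + count (f ∘ suc) p        ≡⟨ cong (count f) (+-comm 1 p) ⟩
  count f (p + 1)                      ≡⟨ count-+ f p 1 ⟩
  count f p + (bit (f (p + 0)) + 0)    ≡⟨ cong (count f p +_) last≡first ⟩
  count f p + bit (f 0)                ≡⟨ +-comm (count f p) _ ⟩
  bit (f 0) + count f p                ∎
  where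
  open ≡-Reasoning
  last≡first : bit (f (p + 0)) + 0 ≡ bit (f 0)
  last≡first = trans (+-identityʳ _) (cong bit (trans (cong f (+-identityʳ p)) fp≡f0))

IsPeriodic : ℕ → (ℕ → Bool) → Set
IsPeriodic p f = ∀ i → f (i + p) ≡ f i

count-periodic-window : ∀ {f} p → IsPeriodic p f → ∀ lo → count (f ∘ (lo +_)) p ≡ count f p
count-periodic-window     p per zero     = refl
count-periodic-window {f} p per (suc lo) = begin
  count (f ∘ (suc lo +_)) p      ≡⟨ count-cong p (λ {i} _ → cong f (sym (+-suc lo i))) ⟩
  count (f ∘ (lo +_) ∘ suc) p    ≡⟨ count-rotate (f ∘ (lo +_)) p f[lo+p]≡f[lo+0] ⟩
  count (f ∘ (lo +_)) p          ≡⟨ count-periodic-window p per lo ⟩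
  count f p                      ∎
  where
  open ≡-Reasoning
  f[lo+p]≡f[lo+0] : f (lo + p) ≡ f (lo + 0)
  f[lo+p]≡f[lo+0] = trans (per lo) (cong f (sym (+-identityʳ lo)))

count-window-+ : ∀ f lo m n →
  count (f ∘ (lo +_)) (m + n) ≡ count (f ∘ (lo +_)) m + count (f ∘ (lo + m +_)) n
count-window-+ f lo m n = trans (count-+ (f ∘ (lo +_)) m n)
  (cong (count (f ∘ (lo +_)) m +_) (count-cong n λ {i} _ → cong f (sym (+-assoc lo m i))))

count-periodic-blocks : ∀ {f} p → IsPeriodic p f → ∀ q lo →
  count (f ∘ (lo +_)) (q * p) ≡ q * count f p
count-periodic-blocks     p per zero    lo = refl
count-periodic-blocks {f} p per (suc q) lo = begin
  count (f ∘ (lo +_)) (p + q * p)                           ≡⟨ count-window-+ f lo p (q * p) ⟩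
  count (f ∘ (lo +_)) p + count (f ∘ (lo + p +_)) (q * p)
    ≡⟨ cong₂ _+_ (count-periodic-window p per lo) (count-periodic-blocks p per q (lo + p)) ⟩
  count f p + q * count f p                                 ∎
  where open ≡-Reasoning

count-blocks-≤ : ∀ f p c q lo → (∀ lo′ → lo′ + p ≤ lo + q * p → count (f ∘ (lo′ +_)) p ≤ c) →
  count (f ∘ (lo +_)) (q * p) ≤ q * c
count-blocks-≤ f p c zero    lo block≤c = z≤n
count-blocks-≤ f p c (suc q) lo block≤c = begin
  count (f ∘ (lo +_)) (p + q * p)                           ≡⟨ count-window-+ f lo p (q * p) ⟩
  count (f ∘ (lo +_)) p + count (f ∘ (lo + p +_)) (q * p)
    ≤⟨ +-mono-≤ (block≤c lo (+-monoʳ-≤ lo (m≤m+n p _)))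
                (count-blocks-≤ f p c q (lo + p) λ lo′ le → block≤c lo′ (≤-trans le (≤-reflexive (+-assoc lo p _)))) ⟩
  c + q * c                                                 ∎
  where open ≤-Reasoning

count-divMod : ∀ f n p .{{_ : NonZero p}} →
  count f n ≡ count f (n % p) + count (f ∘ (n % p +_)) (n / p * p)
count-divMod f n p = trans (cong (count f) (m≡m%n+[m/n]*n n p)) (count-+ f (n % p) (n / p * p))

count-≤-windows : ∀ f n p c .{{_ : NonZero p}} →
  (∀ lo len → len ≤ p → lo + len ≤ n → count (f ∘ (lo +_)) len ≤ c) →
  count f n ≤ c * (n / p) + (n % p) ⊓ c
count-≤-windows f n p c window≤c = begin
  count f n                                      ≡⟨ count-divMod f n p ⟩
  count f r + count (f ∘ (r +_)) (q * p)         ≤⟨ +-mono-≤ (⊓-glb (count≤n f r) prefix≤c) blocks≤qc ⟩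
  r ⊓ c + q * c                                  ≡⟨ +-comm (r ⊓ c) _ ⟩
  q * c + r ⊓ c                                  ≡⟨ cong (_+ r ⊓ c) (*-comm q c) ⟩
  c * q + r ⊓ c                                  ∎
  where
  open ≤-Reasoning
  r = n % p
  q = n / p
  r+qp≡n : r + q * p ≡ n
  r+qp≡n = sym (m≡m%n+[m/n]*n n p)
  prefix≤c : count f r ≤ c
  prefix≤c = window≤c 0 r (<⇒≤ (m%n<n n p)) (m%n≤m n p)
  blocks≤qc : count (f ∘ (r +_)) (q * p) ≤ q * c
  blocks≤qc = count-blocks-≤ f p c q r λ lo le → window≤c lo p ≤-refl (≤-trans le (≤-reflexive r+qp≡n))

count-∧-≤-window : ∀ (f g : ℕ → Bool) len n → (∀ {i} → T (g i) → lo ≤ i × i < lo + len) →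
  count (λ i → f i ∧ g i) n ≤ count (f ∘ (lo +_)) len
count-∧-≤-window {lo} f g len n g⊆window = begin
  count h n                                   ≤⟨ count-monoˡ h (m≤n+m n (lo + len)) ⟩
  count h (lo + len + n)                      ≡⟨ count-+ h (lo + len) n ⟩
  count h (lo + len) + count (h ∘ (lo + len +_)) n
    ≡⟨ cong₂ _+_ (count-+ h lo len) (count-none n λ {i} _ t → <⇒≱ (after (lo + len + i) t) (m≤m+n _ i)) ⟩
  count h lo + count (h ∘ (lo +_)) len + 0
    ≡⟨ cong (λ z → z + count (h ∘ (lo +_)) len + 0) (count-none lo λ {i} i<lo t → <⇒≱ i<lo (before i t)) ⟩
  0 + count (h ∘ (lo +_)) len + 0             ≡⟨ +-identityʳ _ ⟩
  count (h ∘ (lo +_)) len                     ≤⟨ count-mono len (λ _ → proj₁ ∘ Equivalence.to T-∧) ⟩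
  count (f ∘ (lo +_)) len                     ∎
  where
  open ≤-Reasoning
  h : ℕ → Bool
  h i = f i ∧ g i
  before : ∀ i → T (h i) → lo ≤ i
  before i = proj₁ ∘ g⊆window ∘ proj₂ ∘ Equivalence.to T-∧
  after : ∀ i → T (h i) → i < lo + len
  after i = proj₂ ∘ g⊆window ∘ proj₂ ∘ Equivalence.to T-∧

count-window-≤-∧ : ∀ (f g : ℕ → Bool) len n → lo + len ≤ n → (∀ {i} → i < len → T (g (lo + i))) →
  count (f ∘ (lo +_)) len ≤ count (λ i → f i ∧ g i) n
count-window-≤-∧ {lo} f g len n lo+len≤n window⊆g = begin
  count (f ∘ (lo +_)) len                ≤⟨ count-mono len (λ i<len t → Equivalence.from T-∧ (t , window⊆g i<len)) ⟩
  count (h ∘ (lo +_)) len                ≤⟨ m≤n+m _ (count h lo) ⟩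
  count h lo + count (h ∘ (lo +_)) len   ≡⟨ count-+ h lo len ⟨
  count h (lo + len)                     ≤⟨ count-monoˡ h lo+len≤n ⟩
  count h n                              ∎
  where
  open ≤-Reasoning
  h : ℕ → Bool
  h i = f i ∧ g i

count-<ᵇ : ∀ r c → count (_<ᵇ c) r ≡ r ⊓ c
count-<ᵇ zero    c       = refl
count-<ᵇ (suc r) zero    = count-none r λ _ ()
count-<ᵇ (suc r) (suc c) = cong suc (count-<ᵇ r c)

lowResidue : (p c : ℕ) .{{_ : NonZero p}} → ℕ → Bool
lowResidue p c i = i % p <ᵇ c

module _ (p c : ℕ) .{{_ : NonZero p}} (c≤p : c ≤ p) where

  lowResidue-periodic : IsPeriodic p (lowResidue p c)
  lowResidue-periodic i = cong (_<ᵇ c) ([m+n]%n≡m%n i p)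

  count-lowResidue-prefix : ∀ r → r ≤ p → count (lowResidue p c) r ≡ r ⊓ c
  count-lowResidue-prefix r r≤p = trans
    (count-cong r λ i<r → cong (_<ᵇ c) (m<n⇒m%n≡m (<-≤-trans i<r r≤p)))
    (count-<ᵇ r c)

  count-lowResidue-period : count (lowResidue p c) p ≡ c
  count-lowResidue-period = trans (count-lowResidue-prefix p ≤-refl) (m≥n⇒m⊓n≡n c≤p)

  count-lowResidue : ∀ n → count (lowResidue p c) n ≡ c * (n / p) + (n % p) ⊓ c
  count-lowResidue n = begin
    count f n                                    ≡⟨ count-divMod f n p ⟩
    count f r + count (f ∘ (r +_)) (q * p)
      ≡⟨ cong₂ _+_ (count-lowResidue-prefix r (<⇒≤ (m%n<n n p)))
                   (count-periodic-blocks p lowResidue-periodic q r) ⟩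
    r ⊓ c + q * count f p                        ≡⟨ cong (λ z → r ⊓ c + q * z) count-lowResidue-period ⟩
    r ⊓ c + q * c                                ≡⟨ +-comm (r ⊓ c) _ ⟩
    q * c + r ⊓ c                                ≡⟨ cong (_+ r ⊓ c) (*-comm q c) ⟩
    c * q + r ⊓ c                                ∎
    where
    open ≡-Reasoning
    f = lowResidue p c
    r = n % p
    q = n / p

  count-lowResidue-window : ∀ lo len → len ≤ p → count (lowResidue p c ∘ (lo +_)) len ≤ c
  count-lowResidue-window lo len len≤p = begin
    count (f ∘ (lo +_)) len    ≤⟨ count-monoˡ (f ∘ (lo +_)) len≤p ⟩
    count (f ∘ (lo +_)) p      ≡⟨ count-periodic-window p lowResidue-periodic lo ⟩
    count f p                  ≡⟨ count-lowResidue-period ⟩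
    c                          ∎
    where
    open ≤-Reasoning
    f = lowResidue p c

-- Extended by false beyond n.
indicator : Subset n → ℕ → Bool
indicator []      _       = false
indicator (b ∷ _) zero    = b
indicator (_ ∷ S) (suc i) = indicator S i

∣∣≡count-indicator : (S : Subset n) → ∣ S ∣ ≡ count (indicator S) n
∣∣≡count-indicator []          = refl
∣∣≡count-indicator (true ∷ S)  = cong suc (∣∣≡count-indicator S)
∣∣≡count-indicator (false ∷ S) = ∣∣≡count-indicator S

indicator-∩ : ∀ (S R : Subset n) i → indicator (S ∩ R) i ≡ indicator S i ∧ indicator R i
indicator-∩ []      []      i       = refl
indicator-∩ (a ∷ S) (b ∷ R) zero    = refl
indicator-∩ (a ∷ S) (b ∷ R) (suc i) = indicator-∩ S R i

∣∩∣≡count-∧ : (S R : Subset n) → ∣ S ∩ R ∣ ≡ count (λ i → indicator S i ∧ indicator R i) n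
∣∩∣≡count-∧ {n} S R = trans (∣∣≡count-indicator (S ∩ R)) (count-cong n λ {i} _ → indicator-∩ S R i)

indicator-toℕ : ∀ (S : Subset n) x → indicator S (toℕ x) ≡ lookup S x
indicator-toℕ (b ∷ S) Fin.zero    = refl
indicator-toℕ (b ∷ S) (Fin.suc x) = indicator-toℕ S x

indicator⇒< : ∀ (S : Subset n) {i} → T (indicator S i) → i < n
indicator⇒< (b ∷ S) {zero}  _ = z<s
indicator⇒< (b ∷ S) {suc i} t = s<s (indicator⇒< S t)

indicator-tabulate : ∀ (h : ℕ → Bool) {i} → i < n → indicator (tabulate {n = n} (h ∘ toℕ)) i ≡ h i
indicator-tabulate h {zero}  z<s       = refl
indicator-tabulate h {suc i} (s<s i<n) = indicator-tabulate (h ∘ suc) i<n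

module _ (G : Graph) where
  open Graph G using (V)

  lookup-vertexSet⁺ : ∀ {ℓ} {g : Vec (Fin V) (suc ℓ)} {x} → x ∈ g → T (lookup (vertexSet G g) x)
  lookup-vertexSet⁺ {g = g} {x} x∈g rewrite lookup∘tabulate (λ y → does (any? (y ≟_) g)) x
    with any? (x ≟_) g
  ... | yes _  = tt
  ... | no x∉g = x∉g x∈g

  lookup-vertexSet⁻ : ∀ {ℓ} {g : Vec (Fin V) (suc ℓ)} {x} → T (lookup (vertexSet G g) x) → x ∈ g
  lookup-vertexSet⁻ {g = g} {x} rewrite lookup∘tabulate (λ y → does (any? (y ≟_) g)) x
    with any? (x ≟_) g
  ... | yes x∈g = λ _ → x∈g

last-∈ : ∀ {A : Set} (w : Vec A (suc ℓ)) → last w ∈ w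
last-∈ (x ∷ [])    = here refl
last-∈ (x ∷ y ∷ w) = there (last-∈ (y ∷ w))

PAdj⇒≤suc : ∀ {x y : Fin n} → PAdj x y → toℕ y ≤ suc (toℕ x)
PAdj⇒≤suc         (inj₁ y≡1+x) = ≤-reflexive y≡1+x
PAdj⇒≤suc {y = y} (inj₂ x≡1+y) = subst (toℕ y ≤_) (cong suc (sym x≡1+y)) (m≤n⇒m≤1+n (n≤1+n (toℕ y)))

-- A walk of length ℓ in P_n moves by one at each step, so it never leaves an interval of ℓ+1
-- vertices; the interval is extended downwards exactly when the new first vertex lies below it.
walk-window : (w : Vec (Fin n) (suc ℓ)) → IsWalk (Path n) w →
  ∃[ lo ] (∀ {v} → v ∈ w → lo ≤ toℕ v × toℕ v ≤ lo + ℓ)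
walk-window (x ∷ []) _ = toℕ x , λ { (here refl) → ≤-refl , ≤-reflexive (sym (+-identityʳ _)) }
walk-window {ℓ = suc ℓ} (x ∷ y ∷ w) (x~y , walk) with walk-window (y ∷ w) walk
... | lo , inside with toℕ x <? lo
...   | yes x<lo = toℕ x , λ
  { (here refl) → ≤-refl , m≤m+n _ _
  ; (there v∈)  → ≤-trans (<⇒≤ x<lo) (proj₁ (inside v∈))
                , ≤-trans (proj₂ (inside v∈))
                          (≤-trans (+-monoˡ-≤ ℓ lo≤1+x) (≤-reflexive (sym (+-suc (toℕ x) ℓ))))
  }
  where
  lo≤1+x : lo ≤ suc (toℕ x)
  lo≤1+x = ≤-trans (proj₁ (inside (here refl))) (PAdj⇒≤suc x~y)
...   | no x≮lo = lo , λ
  { (here refl) → ≮⇒≥ x≮lo , ≤-trans (PAdj⇒≤suc (Graph.sym (Path _) x~y)) 1+y≤lo+1+ℓ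
  ; (there v∈)  → proj₁ (inside v∈) , ≤-trans (proj₂ (inside v∈)) (+-monoʳ-≤ lo (n≤1+n ℓ))
  }
  where
  1+y≤lo+1+ℓ : suc (toℕ y) ≤ lo + suc ℓ
  1+y≤lo+1+ℓ = ≤-trans (s≤s (proj₂ (inside (here refl)))) (≤-reflexive (sym (+-suc lo ℓ)))

walk-length-≥ : (w : Vec (Fin n) (suc ℓ)) → IsWalk (Path n) w → toℕ (head w) + m ≡ toℕ (last w) → m ≤ ℓ
walk-length-≥ {m = m} w@(_ ∷ _) walk climb with walk-window w walk
... | lo , inside = +-cancelˡ-≤ lo _ _ $ begin
  lo + m                ≤⟨ +-monoˡ-≤ m (proj₁ (inside (here refl))) ⟩
  toℕ (head w) + m      ≡⟨ climb ⟩
  toℕ (last w)          ≤⟨ proj₂ (inside (last-∈ w)) ⟩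
  lo + _                ∎
  where open ≤-Reasoning

vertexSet-window : (g : Vec (Fin n) (suc ℓ)) → IsWalk (Path n) g →
  ∃[ lo ] (∀ {i} → T (indicator (vertexSet (Path n) g) i) → lo ≤ i × i < lo + suc ℓ)
vertexSet-window {n} {ℓ} g walk with walk-window g walk
... | lo , inside = lo , bounds
  where
  V = vertexSet (Path n) g
  bounds : ∀ {i} → T (indicator V i) → lo ≤ i × i < lo + suc ℓ
  bounds {i} t = subst (λ j → lo ≤ j × j < lo + suc ℓ) (toℕ-fromℕ< i<n)
    (proj₁ (inside x∈g) , ≤-trans (s≤s (proj₂ (inside x∈g))) (≤-reflexive (sym (+-suc lo ℓ))))
    where
    i<n = indicator⇒< V t
    x∈g : fromℕ< i<n ∈ g
    x∈g = lookup-vertexSet⁻ (Path n) $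
      subst T (trans (cong (indicator V) (sym (toℕ-fromℕ< i<n))) (indicator-toℕ V _)) t

∣∩vertexSet∣≤window : ∀ (S : Subset n) (g : Vec (Fin n) (suc ℓ)) → IsWalk (Path n) g →
  ∃[ lo ] ∣ S ∩ vertexSet (Path n) g ∣ ≤ count (indicator S ∘ (lo +_)) (suc ℓ)
∣∩vertexSet∣≤window {n} {ℓ} S g walk with vertexSet-window g walk
... | lo , bounds = lo , ≤-trans (≤-reflexive (∣∩∣≡count-∧ S V))
                                 (count-∧-≤-window (indicator S) (indicator V) (suc ℓ) n bounds)
  where V = vertexSet (Path n) g

ascend : ∀ lo m → lo + m < n → Vec (Fin n) (suc m)
ascend     lo zero    p = fromℕ< (m+n≤o⇒m≤o (suc lo) p) ∷ []
ascend {n} lo (suc m) p = fromℕ< (m+n≤o⇒m≤o (suc lo) p) ∷ ascend (suc lo) m (subst (_< n) (+-suc lo m) p)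

ascend-head : ∀ lo m (p : lo + m < n) → toℕ (head (ascend lo m p)) ≡ lo
ascend-head lo zero    p = toℕ-fromℕ< _
ascend-head lo (suc m) p = toℕ-fromℕ< _

ascend-last : ∀ lo m (p : lo + m < n) → toℕ (last (ascend lo m p)) ≡ lo + m
ascend-last lo zero          p = trans (toℕ-fromℕ< _) (sym (+-identityʳ lo))
ascend-last lo (suc zero)    p = trans (toℕ-fromℕ< _) (+-comm 1 lo)
ascend-last lo (suc (suc m)) p = trans (ascend-last (suc lo) (suc m) _) (sym (+-suc lo (suc m)))

ascend-walk : ∀ lo m (p : lo + m < n) → IsWalk (Path n) (ascend lo m p)
ascend-walk lo zero    p = tt
ascend-walk lo (suc m) p =
  ∷-walk (inj₁ (trans (ascend-head (suc lo) m _) (cong suc (sym (toℕ-fromℕ< _))))) (ascend-walk (suc lo) m _)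
  where
  ∷-walk : ∀ {x} {w : Vec (Fin n) (suc m)} → PAdj x (head w) → IsWalk (Path n) w → IsWalk (Path n) (x ∷ w)
  ∷-walk {w = _ ∷ _} x~y walk = x~y , walk

ascend-geodesic : ∀ lo m (p : lo + m < n) → IsGeodesic (Path n) m (ascend lo m p)
ascend-geodesic lo m p = ascend-walk lo m p , λ m′ w walk same-head same-last →
  walk-length-≥ w walk $ begin
    toℕ (head w) + m                  ≡⟨ cong (λ x → toℕ x + m) same-head ⟩
    toℕ (head (ascend lo m p)) + m    ≡⟨ cong (_+ m) (ascend-head lo m p) ⟩
    lo + m                            ≡⟨ ascend-last lo m p ⟨
    toℕ (last (ascend lo m p))        ≡⟨ cong toℕ same-last ⟨
    toℕ (last w)                      ∎
  where open ≡-Reasoning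

ascend-∋ : ∀ lo m (p : lo + m < n) i → i ≤ m → ∃[ v ] v ∈ ascend lo m p × toℕ v ≡ lo + i
ascend-∋ lo zero    p zero    _ = _ , here refl , trans (toℕ-fromℕ< _) (sym (+-identityʳ lo))
ascend-∋ lo (suc m) p zero    _ = _ , here refl , trans (toℕ-fromℕ< _) (sym (+-identityʳ lo))
ascend-∋ lo (suc m) p (suc i) i≤m with ascend-∋ (suc lo) m _ i (s≤s⁻¹ i≤m)
... | v , v∈ , v≡ = v , there v∈ , trans v≡ (sym (+-suc lo i))

window≤∣∩ascend∣ : ∀ (S : Subset n) lo m (p : lo + m < n) →
  count (indicator S ∘ (lo +_)) (suc m) ≤ ∣ S ∩ vertexSet (Path n) (ascend lo m p) ∣
window≤∣∩ascend∣ {n} S lo m p = ≤-trans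
  (count-window-≤-∧ (indicator S) (indicator V) (suc m) n (subst (_≤ n) (sym (+-suc lo m)) p) window⊆V)
  (≤-reflexive (sym (∣∩∣≡count-∧ S V)))
  where
  V = vertexSet (Path n) (ascend lo m p)
  window⊆V : ∀ {i} → i < suc m → T (indicator V (lo + i))
  window⊆V {i} i<1+m with ascend-∋ lo m p i (s≤s⁻¹ i<1+m)
  ... | v , v∈ , v≡ = subst (T ∘ indicator V) v≡
    (subst T (sym (indicator-toℕ V v)) (lookup-vertexSet⁺ (Path n) v∈))

IsGenPos⇒window≤ : ∀ {c d} (S : Subset n) → IsGenPos (Path n) (suc c) d S →
  ∀ lo len → len ≤ suc d → lo + len ≤ n → count (indicator S ∘ (lo +_)) len ≤ c
IsGenPos⇒window≤ S gp lo zero    _      _         = z≤n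
IsGenPos⇒window≤ {n} S gp lo (suc m) 1+m≤1+d lo+1+m≤n = ≮⇒≥ λ c<count →
  <⇒≱ (gp m (ascend lo m p) (ascend-geodesic lo m p) (≤-trans c<count (window≤∣∩ascend∣ S lo m p)))
      (s≤s⁻¹ 1+m≤1+d)
  where
  p : lo + m < n
  p = subst (_≤ n) (+-suc lo m) lo+1+m≤n

window≤⇒IsGenPos : ∀ {c d} (S : Subset n) → (∀ lo len → len ≤ suc d → count (indicator S ∘ (lo +_)) len ≤ c) →
  IsGenPos (Path n) (suc c) d S
window≤⇒IsGenPos {d = d} S window≤c ℓ g (walk , _) c<∣S∩V∣ with ∣∩vertexSet∣≤window S g walk
... | lo , ∣S∩V∣≤window = ≰⇒> λ ℓ≤d →
  <⇒≱ (≤-trans c<∣S∩V∣ ∣S∩V∣≤window) (window≤c lo (suc ℓ) (s≤s ℓ≤d))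

IsGP-Path-⊤ : ∀ {k d} → suc d < k → IsGP (Path n) k d n
IsGP-Path-⊤ {n} {suc c} {d} (s≤s 1+d≤c) =
  (⊤ , window≤⇒IsGenPos ⊤ window≤c , ∣⊤∣≡n n) , λ S _ → ∣p∣≤n S
  where
  window≤c : ∀ lo len → len ≤ suc d → count (indicator (⊤ {n}) ∘ (lo +_)) len ≤ c
  window≤c lo len len≤1+d = ≤-trans (count≤n (indicator (⊤ {n}) ∘ (lo +_)) len) (≤-trans len≤1+d 1+d≤c)

IsGP-Path-lowResidue : ∀ {c d} → c ≤ d → IsGP (Path n) (suc c) d (c * (n / suc d) + (n % suc d) ⊓ c)
IsGP-Path-lowResidue {n} {c} {d} c≤d =
  (S₀ , window≤⇒IsGenPos S₀ S₀-window≤c , ∣S₀∣≡) , λ S gp → ≤-trans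
    (≤-reflexive (∣∣≡count-indicator S))
    (count-≤-windows (indicator S) n (suc d) c (IsGenPos⇒window≤ S gp))
  where
  c≤1+d = m≤n⇒m≤1+n c≤d
  f = lowResidue (suc d) c
  S₀ : Subset n
  S₀ = tabulate (f ∘ toℕ)
  ∣S₀∣≡ : ∣ S₀ ∣ ≡ c * (n / suc d) + (n % suc d) ⊓ c
  ∣S₀∣≡ = trans (∣∣≡count-indicator S₀)
          (trans (count-cong n (indicator-tabulate f)) (count-lowResidue (suc d) c c≤1+d n))
  S₀-window≤c : ∀ lo len → len ≤ suc d → count (indicator S₀ ∘ (lo +_)) len ≤ c
  S₀-window≤c lo len len≤1+d = ≤-trans
    (count-mono len λ _ t → subst T (indicator-tabulate f (indicator⇒< S₀ t)) t)
    (count-lowResidue-window (suc d) c c≤1+d lo len len≤1+d)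

theorem3p3 : ∀ (d k n : ℕ) → 1 ≤ d → 2 ≤ k → k ≤ n →
    (d ≤ k ∸ 2 → IsGP (Path n) k d n) ×
    (k ∸ 1 ≤ d → IsGP (Path n) k d ((k ∸ 1) * (n / suc d) + (n % suc d) ⊓ (k ∸ 1)))
theorem3p3 d (suc c) n _ (s≤s 1≤c) _ =
  (λ d≤c∸1 → IsGP-Path-⊤ (s≤s (≤-trans (+-monoʳ-≤ 1 d≤c∸1) (≤-reflexive (m+[n∸m]≡n 1≤c))))) ,
  IsGP-Path-lowResidue
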